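{- Let $q\equiv 5\pmod 8$ be a prime power and let $(a_0,b_0)\in V(\mathbb{F}_q)$ be such that $(a_{ -1},b_{ -1})\mapsto(a_0,b_0)\mapsto(a_1,b_1)$ for some $(a_{ -1},b_{ -1}),(a_1,b_1)\in V(\mathbb{F}_q)$. Then: (1) There exists $(a_0',b_0')\in V(\mathbb{F}_q)$ with $\mathrm{AGM}(a_0',b_0')=\mathrm{AGM}(a_0,b_0)$, namely $a_0'=b_0$, $b_0'=a_0$. (2) There exists $(a_{ -1}',b_{ -1}')\in V(\mathbb{F}_q)$ with $(a_{ -1}',b_{ -1}')\mapsto(a_0',b_0')$. (3) For such $(a_{ -1}',b_{ -1}')$, exactly one of the following holds: (a) there exists $(a_{ -2},b_{ -2})\in V(\mathbb{F}_q)$ with $(a_{ -2},b_{ -2})\mapsto(a_{ -1},b_{ -1})$; (b) there exists $(a_{ -2}',b_{ -2}')\in V(\mathbb{F}_q)$ with $(a_{ -2}',b_{ -2}')\mapsto(a_{ -1}',b_{ -1}')$.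
   Context: $V(\mathbb{F}_q)=\{(a,b)\in\mathbb{F}_q^2: a\neq 0,\ b\neq 0,\ a\neq \pm b\}$. For $(a,b)\in V(\mathbb{F}_q)$: if $ab$ is a square in $\mathbb{F}_q^\times$, $\mathrm{AGM}(a,b)=\{(\tfrac{a+b}{2},s),(\tfrac{a+b}{2},-s)\}$ with $s^2=ab$; otherwise $\mathrm{AGM}(a,b)=\varnothing$. $(a,b)\mapsto(a',b')$ means $(a',b')\in\mathrm{AGM}(a,b)$. -}

module Defs where

open import Level using (Level; suc; _⊔_)
open import Data.Nat using (ℕ; _^_; _%_)
import Data.Nat as ℕ
open import Data.Nat.Primality using (Prime)
open import Data.Fin using (Fin)
open import Data.Product using (Σ; ∃; ∃-syntax; _×_; _,_)
open import Data.Sum using (_⊎_)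
open import Relation.Nullary using (¬_)
open import Relation.Binary.PropositionalEquality using (_≡_; _≢_)
open import Algebra.Structures using (IsCommutativeRing)
open import Function.Bundles using (_↔_)

IsPrimePower : ℕ → Set
IsPrimePower q = ∃[ p ] ∃[ k ] (Prime p × q ≡ p ^ ℕ.suc k)

record FiniteField (q : ℕ) : Set₁ where
  infixl 7 _*_
  infixl 6 _+_
  infix  8 -_
  field
    Carrier : Set
    _+_ _*_ : Carrier → Carrier → Carrier
    -_      : Carrier → Carrier
    0# 1#   : Carrier
    isCommutativeRing : IsCommutativeRing _≡_ _+_ _*_ -_ 0# 1#
    0≢1     : 0# ≢ 1#
    inverse : ∀ x → x ≢ 0# → ∃[ y ] (x * y ≡ 1#)
    card    : Carrier ↔ Fin q

  2# : Carrier
  2# = 1# + 1#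

  V : Carrier → Carrier → Set
  V a b = a ≢ 0# × b ≢ 0# × a ≢ b × a ≢ - b

  IsSquareUnit : Carrier → Set
  IsSquareUnit x = ∃[ t ] (t ≢ 0# × t * t ≡ x)

  -- (a',b') ∈ AGM(a,b): AGM(a,b) = {((a+b)/2, s), ((a+b)/2, -s)} with s² = ab
  -- when ab is a square in F_q^×, and ∅ otherwise.  a' = (a+b)/2 is written
  -- as a' · 2 = a + b (2 is invertible since q is odd).
  AGM : Carrier → Carrier → Carrier → Carrier → Set
  AGM a b a' b' =
    IsSquareUnit (a * b) ×
    ∃[ s ] (s * s ≡ a * b × a' * 2# ≡ a + b × (b' ≡ s ⊎ b' ≡ - s))

  _↦_ : Carrier × Carrier → Carrier × Carrier → Set
  (a , b) ↦ (a' , b') = AGM a b a' b'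

-- Write Δ(a, b) = a² - b².  A pair (a, b) ∈ V has a preimage in V under the AGM
-- map iff Δ(a, b) is a nonzero square: the preimages are (a + t, a - t) with
-- t² = Δ(a, b).  Counting squares (squaring is two-to-one on F_q^×) shows that
-- for q ≡ 5 (mod 8) the element -1 = i² is a square, i is not, and the product
-- of two nonsquares is a square.  Then Δ(b₀, a₀) = i² Δ(a₀, b₀) gives (2).  For
-- (3), if (a, b) ↦ (a₀, b₀) and (c, e) ↦ (b₀, a₀) then (c - e)² = -(a - b)², and
--   i Δ(a, b) Δ(c, e) = 4 a₀ b₀ · i (a - b)(c - e)
-- is a square because a₀ b₀ is one (as (a₀, b₀) has an image) and
-- c - e = ± i (a - b).  So Δ(a, b) Δ(c, e) is a nonsquare, i.e. exactly one of
-- Δ(a, b), Δ(c, e) is a square.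
module Submission where

open import Defs
open import Data.Nat using (ℕ; _%_)
open import Data.Product using (Σ; ∃; ∃-syntax; _×_; _,_)
open import Data.Sum using (_⊎_)
open import Relation.Nullary using (¬_)
open import Relation.Binary.PropositionalEquality using (_≡_)
open import Function.Bundles using (_⇔_)

open import Level using (0ℓ)
open import Algebra.Bundles using (CommutativeRing)
open import Algebra.Solver.Ring.AlmostCommutativeRing
  using (_-Raw-AlmostCommutative⟶_; Induced-equivalence; fromCommutativeRing)
open import Data.Empty using (⊥-elim)
open import Data.Fin as Fin using (Fin)
open import Data.Integer as ℤ using (ℤ; +_; -[1+_]; _⊖_)
import Data.Integer.Properties as ℤ
open import Data.List using (List; []; _∷_; map; filter; length; tabulate)
open import Data.List.Properties using (length-map; length-tabulate; filter-all; filter-notAll; filter-some; filter-≐)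
open import Data.List.Membership.Propositional using (_∈_; lose)
open import Data.List.Membership.Propositional.Properties using (∈-tabulate⁺; ∈-filter⁺; ∈-filter⁻; ∈-map⁻)
open import Data.List.Relation.Binary.Subset.Propositional using (_⊆_)
import Data.List.Relation.Unary.All as All
open import Data.List.Relation.Unary.AllPairs using ([]; _∷_)
import Data.List.Relation.Unary.All.Properties as All
open import Data.List.Relation.Unary.Any using (here; there; any?; satisfied)
import Data.List.Relation.Unary.Any as Any
open import Data.List.Relation.Unary.Unique.Propositional using (Unique)
import Data.List.Relation.Unary.Unique.Propositional.Properties as Unique
import Data.Maybe as Maybe
open import Data.Nat as ℕ using (zero; suc; z≤n; s≤s; _≤_)
import Data.Nat.Properties as ℕ
open import Data.Nat.DivMod using ([m+kn]%n≡m%n; m∣n⇒o%n%m≡o%m)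
open import Data.Nat.Divisibility using (divides)
open import Data.Nat.Tactic.RingSolver using (solve-∀)
open import Data.Product using (proj₁; proj₂)
open import Data.Sum using (inj₁; inj₂)
import Data.Sum as Sum
open import Function.Bundles using (_↔_; Inverse; Injection; mk⇔)
open import Function.Construct.Symmetry using (↔-sym)
open import Function.Properties.Inverse using (↔⇒↣)
open import Relation.Binary.Consequences using (dec⇒weaklyDec)
open import Relation.Binary.Definitions using (WeaklyDecidable; DecidableEquality)
open import Relation.Binary.PropositionalEquality as ≡ using (refl; cong; subst; _≢_)
open import Relation.Nullary using (Dec; yes; no; contradiction)
open import Relation.Nullary.Decidable using (via-injection; _×-dec_; ¬?; decidable-stable)
open import Relation.Unary using (Pred; Decidable; _∩_; ∁; _≐_)
open import Relation.Unary.Properties using (U?; _∩?_; ∁?)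

-- The reflective solver of Tactic.RingSolver takes its coefficients from the
-- ring itself, so in an abstract ring it cannot cancel (1# + - 1#) against 0#.
-- With integer coefficients normal forms are decidable, which is all the old
-- solver needs.
module IntegerCoefficientRingSolver {c ℓ} (R : CommutativeRing c ℓ) where
  open CommutativeRing R renaming (refl to ≈-refl)
  open import Algebra.Properties.Ring ring
    using (-‿distribˡ-*; -‿distribʳ-*; -‿+-comm; -‿involutive; -0#≈0#)
  open import Algebra.Properties.CommutativeSemigroup +-commutativeSemigroup using (interchange)
  open import Algebra.Properties.Monoid.Mult.TCOptimised +-monoid using (×-homo-+; 1+×) renaming (_×_ to _×′_)
  open import Algebra.Properties.Semiring.Mult.TCOptimised semiring using (×1-homo-*)
  open import Relation.Binary.Reasoning.Setoid setoid

  -- The optimised multiple makes ⟦ + 2 ⟧ℤ definitionally 1# + 1#.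
  ⟦_⟧ℤ : ℤ → Carrier
  ⟦ + n ⟧ℤ      = n ×′ 1#
  ⟦ -[1+ n ] ⟧ℤ = - (suc n ×′ 1#)

  -‿homo : ∀ i → ⟦ ℤ.- i ⟧ℤ ≈ - ⟦ i ⟧ℤ
  -‿homo (+ zero)  = sym -0#≈0#
  -‿homo (+ suc n) = ≈-refl
  -‿homo -[1+ n ]  = sym (-‿involutive _)

  ⊖-homo : ∀ m n → ⟦ m ⊖ n ⟧ℤ ≈ m ×′ 1# - n ×′ 1#
  ⊖-homo m zero = begin
    m ×′ 1#       ≈⟨ +-identityʳ _ ⟨
    m ×′ 1# + 0#  ≈⟨ +-congˡ -0#≈0# ⟨
    m ×′ 1# - 0#  ∎
  ⊖-homo zero (suc n) = sym (+-identityˡ _)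
  ⊖-homo (suc m) (suc n) = begin
    ⟦ suc m ⊖ suc n ⟧ℤ               ≡⟨ cong ⟦_⟧ℤ (ℤ.[1+m]⊖[1+n]≡m⊖n m n) ⟩
    ⟦ m ⊖ n ⟧ℤ                       ≈⟨ ⊖-homo m n ⟩
    m ×′ 1# - n ×′ 1#                  ≈⟨ +-identityˡ _ ⟨
    0# + (m ×′ 1# - n ×′ 1#)           ≈⟨ +-congʳ (-‿inverseʳ 1#) ⟨
    (1# - 1#) + (m ×′ 1# - n ×′ 1#)    ≈⟨ interchange 1# (- 1#) _ _ ⟩
    (1# + m ×′ 1#) + (- 1# - n ×′ 1#)  ≈⟨ +-congˡ (-‿+-comm 1# _) ⟩
    (1# + m ×′ 1#) - (1# + n ×′ 1#)    ≈⟨ +-cong (1+× m 1#) (-‿cong (1+× n 1#)) ⟨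
    suc m ×′ 1# - suc n ×′ 1#          ∎

  +-homo : ∀ i j → ⟦ i ℤ.+ j ⟧ℤ ≈ ⟦ i ⟧ℤ + ⟦ j ⟧ℤ
  +-homo (+ m)    (+ n)    = ×-homo-+ 1# m n
  +-homo (+ m)    -[1+ n ] = ⊖-homo m (suc n)
  +-homo -[1+ m ] (+ n)    = trans (⊖-homo n (suc m)) (+-comm _ _)
  +-homo -[1+ m ] -[1+ n ] = begin
    - (suc (suc (m ℕ.+ n)) ×′ 1#)   ≡⟨ cong (λ k → - (k ×′ 1#)) (ℕ.+-suc (suc m) n) ⟨
    - ((suc m ℕ.+ suc n) ×′ 1#)     ≈⟨ -‿cong (×-homo-+ 1# (suc m) (suc n)) ⟩
    - (suc m ×′ 1# + suc n ×′ 1#)    ≈⟨ -‿+-comm _ _ ⟨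
    - (suc m ×′ 1#) - suc n ×′ 1#    ∎

  *-homo-+ : ∀ m j → ⟦ + m ℤ.* j ⟧ℤ ≈ ⟦ + m ⟧ℤ * ⟦ j ⟧ℤ
  *-homo-+ m (+ n) = begin
    ⟦ + m ℤ.* + n ⟧ℤ     ≡⟨ cong ⟦_⟧ℤ (ℤ.pos-* m n) ⟨
    (m ℕ.* n) ×′ 1#       ≈⟨ ×1-homo-* m n ⟩
    m ×′ 1# * (n ×′ 1#)    ∎
  *-homo-+ m -[1+ n ] = begin
    ⟦ + m ℤ.* ℤ.- + suc n ⟧ℤ     ≡⟨ cong ⟦_⟧ℤ (ℤ.neg-distribʳ-* (+ m) (+ suc n)) ⟨
    ⟦ ℤ.- (+ m ℤ.* + suc n) ⟧ℤ   ≈⟨ -‿homo (+ m ℤ.* + suc n) ⟩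
    - ⟦ + m ℤ.* + suc n ⟧ℤ       ≈⟨ -‿cong (*-homo-+ m (+ suc n)) ⟩
    - (m ×′ 1# * (suc n ×′ 1#))    ≈⟨ -‿distribʳ-* _ _ ⟩
    m ×′ 1# * - (suc n ×′ 1#)      ∎

  *-homo : ∀ i j → ⟦ i ℤ.* j ⟧ℤ ≈ ⟦ i ⟧ℤ * ⟦ j ⟧ℤ
  *-homo (+ m)    j = *-homo-+ m j
  *-homo -[1+ m ] j = begin
    ⟦ ℤ.- + suc m ℤ.* j ⟧ℤ     ≡⟨ cong ⟦_⟧ℤ (ℤ.neg-distribˡ-* (+ suc m) j) ⟨
    ⟦ ℤ.- (+ suc m ℤ.* j) ⟧ℤ   ≈⟨ -‿homo (+ suc m ℤ.* j) ⟩
    - ⟦ + suc m ℤ.* j ⟧ℤ       ≈⟨ -‿cong (*-homo-+ (suc m) j) ⟩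
    - (suc m ×′ 1# * ⟦ j ⟧ℤ)    ≈⟨ -‿distribˡ-* _ _ ⟩
    - (suc m ×′ 1#) * ⟦ j ⟧ℤ    ∎

  ℤ⟶R : ℤ.+-*-rawRing -Raw-AlmostCommutative⟶ fromCommutativeRing R
  ℤ⟶R = record
    { ⟦_⟧ = ⟦_⟧ℤ ; +-homo = +-homo ; *-homo = *-homo ; -‿homo = -‿homo
    ; 0-homo = ≈-refl ; 1-homo = ≈-refl }

  _≟ℤ_ : WeaklyDecidable (Induced-equivalence ℤ⟶R)
  i ≟ℤ j = Maybe.map (λ i≡j → reflexive (cong ⟦_⟧ℤ i≡j)) (dec⇒weaklyDec ℤ._≟_ i j)

  open import Algebra.Solver.Ring ℤ.+-*-rawRing (fromCommutativeRing R) ℤ⟶R _≟ℤ_ public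
    using (Polynomial; solve; _:=_; _:+_; _:*_; _:-_; :-_; con)

  :0 :1 :2 : ∀ {n} → Polynomial n
  :0 = con (+ 0)
  :1 = con (+ 1)
  :2 = con (+ 2)

unique-map⁺ : {A B : Set} (f : A → B) {xs : List A} →
              (∀ {x y} → x ∈ xs → y ∈ xs → f x ≡ f y → x ≡ y) → Unique xs → Unique (map f xs)
unique-map⁺ f {[]}     _   []            = []
unique-map⁺ f {x ∷ xs} inj (x∉xs ∷ xs!) =
  All.map⁺ (All.tabulate λ y∈xs fx≡fy → All.lookup x∉xs y∈xs (inj (here refl) (there y∈xs) fx≡fy))
  ∷ unique-map⁺ f (λ x∈xs y∈xs → inj (there x∈xs) (there y∈xs)) xs!

unique-⊆⇒length≤ : {A : Set} → DecidableEquality A →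
                   {xs ys : List A} → Unique xs → xs ⊆ ys → length xs ≤ length ys
unique-⊆⇒length≤ _≟_ {[]}     _             _      = z≤n
unique-⊆⇒length≤ _≟_ {x ∷ xs} {ys} (x∉xs ∷ xs!) xs⊆ys =
  ℕ.≤-trans (s≤s (unique-⊆⇒length≤ _≟_ xs! xs⊆ys-x))
            (filter-notAll ≢x? ys (Any.map (λ x≡y x≢y → x≢y x≡y) (xs⊆ys (here refl))))
  where
  ≢x? : Decidable (x ≢_)
  ≢x? y = ¬? (x ≟ y)
  xs⊆ys-x : xs ⊆ filter ≢x? ys
  xs⊆ys-x y∈xs = ∈-filter⁺ ≢x? (xs⊆ys (there y∈xs)) (All.lookup x∉xs y∈xs)

module Counting {A : Set} {n : ℕ} (card : A ↔ Fin n) where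

  _≟_ : DecidableEquality A
  _≟_ = via-injection (↔⇒↣ card) Fin._≟_

  elements : List A
  elements = tabulate (Inverse.from card)

  ∈-elements : ∀ x → x ∈ elements
  ∈-elements x = subst (_∈ elements) (Inverse.strictlyInverseʳ card x) (∈-tabulate⁺ (Inverse.to card x))

  elements-unique : Unique elements
  elements-unique = Unique.tabulate⁺ (Injection.injective (↔⇒↣ (↔-sym card)))

  ∃? : {P : Pred A 0ℓ} → Decidable P → Dec (∃ P)
  ∃? P? with any? P? elements
  ... | yes some = yes (satisfied some)
  ... | no none  = no λ (x , px) → none (lose (∈-elements x) px)

  count : {P : Pred A 0ℓ} → Decidable P → ℕ
  count P? = length (filter P? elements)

  count-U : count U? ≡ n
  count-U = ≡.trans (cong length (filter-all U? (All.universal _ elements))) (length-tabulate _)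

  count-cong : {P Q : Pred A 0ℓ} (P? : Decidable P) (Q? : Decidable Q) → P ≐ Q → count P? ≡ count Q?
  count-cong P? Q? P≐Q = cong length (filter-≐ P? Q? P≐Q elements)

  count-split : {P Q : Pred A 0ℓ} (P? : Decidable P) (Q? : Decidable Q) →
                count P? ≡ count (P? ∩? Q?) ℕ.+ count (P? ∩? ∁? Q?)
  count-split {P} {Q} P? Q? = split elements
    where
    split : ∀ xs → length (filter P? xs) ≡
                   length (filter (P? ∩? Q?) xs) ℕ.+ length (filter (P? ∩? ∁? Q?) xs)
    split [] = refl
    split (x ∷ xs) with P? x | Q? x
    ... | yes _ | yes _ = cong suc (split xs)
    ... | yes _ | no _  = ≡.trans (cong suc (split xs)) (≡.sym (ℕ.+-suc _ _))
    ... | no _  | _     = split xs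

  injective⇒count≤ : {P Q : Pred A 0ℓ} (P? : Decidable P) (Q? : Decidable Q) (f : A → A) →
                     (∀ {x} → P x → Q (f x)) → (∀ {x y} → P x → P y → f x ≡ f y → x ≡ y) →
                     count P? ≤ count Q?
  injective⇒count≤ P? Q? f P⇒Qf f-injective =
    subst (_≤ count Q?) (length-map f Ps) (unique-⊆⇒length≤ _≟_ fPs! fPs⊆Qs)
    where
    Ps = filter P? elements
    inPs : ∀ {x} → x ∈ Ps → _
    inPs x∈Ps = proj₂ (∈-filter⁻ P? {xs = elements} x∈Ps)
    fPs! : Unique (map f Ps)
    fPs! = unique-map⁺ f (λ x∈ y∈ → f-injective (inPs x∈) (inPs y∈)) (Unique.filter⁺ P? elements-unique)
    fPs⊆Qs : map f Ps ⊆ filter Q? elements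
    fPs⊆Qs y∈fPs with ∈-map⁻ f y∈fPs
    ... | x , x∈Ps , refl = ∈-filter⁺ Q? (∈-elements (f x)) (P⇒Qf (inPs x∈Ps))

  count-singleton : {P : Pred A 0ℓ} (P? : Decidable P) {c : A} → P c → count (P? ∩? (_≟ c)) ≡ 1
  count-singleton P? {c} Pc = ℕ.≤-antisym
    (unique-⊆⇒length≤ _≟_ {ys = c ∷ []} (Unique.filter⁺ (P? ∩? (_≟ c)) elements-unique)
                      (λ x∈ → here (proj₂ (proj₂ (∈-filter⁻ (P? ∩? (_≟ c)) {xs = elements} x∈)))))
    (filter-some (P? ∩? (_≟ c)) {xs = elements} (lose (∈-elements c) (Pc , refl)))

  image : (A → A) → Pred A 0ℓ → Pred A 0ℓ
  image f P y = ∃[ x ] (P x × f x ≡ y)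

  image? : (f : A → A) {P : Pred A 0ℓ} → Decidable P → Decidable (image f P)
  image? f P? y = ∃? (λ x → P? x ×-dec (f x ≟ y))

  count-two-to-one : {P : Pred A 0ℓ} (P? : Decidable P) (φ σ : A → A) →
    (∀ {x} → P x → P (σ x)) → (∀ {x} → P x → σ x ≢ x) → (∀ {x} → P x → φ (σ x) ≡ φ x) →
    (∀ {x y} → P x → P y → φ x ≡ φ y → x ≡ y ⊎ x ≡ σ y) →
    count P? ≡ 2 ℕ.* count (image? φ P?)
  count-two-to-one {P} P? φ σ σ-closed σ-fixedPointFree φ∘σ≡φ φ-fibres = begin
    count P?                                                  ≡⟨ count-split P? Canonical? ⟩
    count (P? ∩? Canonical?) ℕ.+ count (P? ∩? ∁? Canonical?)  ≡⟨ ≡.cong₂ ℕ._+_ canonical≡image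
                                                                                noncanonical≡image ⟩
    count Im? ℕ.+ count Im?                                   ≡⟨ cong (count Im? ℕ.+_) (ℕ.+-identityʳ _) ⟨
    2 ℕ.* count Im?                                           ∎
    where
    open ≡.≡-Reasoning
    Im? = image? φ P?

    representative : A → A
    representative y with Im? y
    ... | yes (x , _) = x
    ... | no _        = y

    representative-spec : ∀ {y} → image φ P y → P (representative y) × φ (representative y) ≡ y
    representative-spec {y} y∈Im with Im? y
    ... | yes (_ , Px , φx≡y) = Px , φx≡y
    ... | no y∉Im             = ⊥-elim (y∉Im y∈Im)

    Canonical : Pred A 0ℓ
    Canonical x = x ≡ representative (φ x)

    Canonical? : Decidable Canonical
    Canonical? x = x ≟ representative (φ x)

    noncanonical⇒σ-representative : ∀ {x} → P x → ¬ Canonical x → x ≡ σ (representative (φ x))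
    noncanonical⇒σ-representative {x} Px ¬canonical
      with φ-fibres Px (proj₁ (representative-spec (x , Px , refl)))
                       (≡.sym (proj₂ (representative-spec (x , Px , refl))))
    ... | inj₁ canonical = ⊥-elim (¬canonical canonical)
    ... | inj₂ x≡σr      = x≡σr

    φ∘representative : ∀ {y} → image φ P y → φ (representative y) ≡ y
    φ∘representative y∈Im = proj₂ (representative-spec y∈Im)

    φ∘σ∘representative : ∀ {y} → image φ P y → φ (σ (representative y)) ≡ y
    φ∘σ∘representative y∈Im =
      ≡.trans (φ∘σ≡φ (proj₁ (representative-spec y∈Im))) (φ∘representative y∈Im)

    canonical≡image : count (P? ∩? Canonical?) ≡ count Im?
    canonical≡image = ℕ.≤-antisym
      (injective⇒count≤ (P? ∩? Canonical?) Im? φ (λ {x} (Px , _) → x , Px , refl)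
        λ (_ , x≡rφx) (_ , y≡rφy) φx≡φy →
          ≡.trans x≡rφx (≡.trans (cong representative φx≡φy) (≡.sym y≡rφy)))
      (injective⇒count≤ Im? (P? ∩? Canonical?) representative
        (λ y∈Im → proj₁ (representative-spec y∈Im) , cong representative (≡.sym (φ∘representative y∈Im)))
        λ x∈Im y∈Im rx≡ry →
          ≡.trans (≡.sym (φ∘representative x∈Im)) (≡.trans (cong φ rx≡ry) (φ∘representative y∈Im)))

    noncanonical≡image : count (P? ∩? ∁? Canonical?) ≡ count Im?
    noncanonical≡image = ℕ.≤-antisym
      (injective⇒count≤ (P? ∩? ∁? Canonical?) Im? φ (λ {x} (Px , _) → x , Px , refl)
        λ (Px , ¬cx) (Py , ¬cy) φx≡φy →
          ≡.trans (noncanonical⇒σ-representative Px ¬cx)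
            (≡.trans (cong (λ z → σ (representative z)) φx≡φy)
              (≡.sym (noncanonical⇒σ-representative Py ¬cy))))
      (injective⇒count≤ Im? (P? ∩? ∁? Canonical?) (λ y → σ (representative y))
        (λ y∈Im → let Pr = proj₁ (representative-spec y∈Im) in
          σ-closed Pr ,
          λ σr-canonical → σ-fixedPointFree Pr
            (≡.trans σr-canonical (cong representative (φ∘σ∘representative y∈Im))))
        λ x∈Im y∈Im σrx≡σry →
          ≡.trans (≡.sym (φ∘σ∘representative x∈Im))
            (≡.trans (cong φ σrx≡σry) (φ∘σ∘representative y∈Im)))

1+2[1+2k]%8≢5 : ∀ k → (1 ℕ.+ 2 ℕ.* (1 ℕ.+ 2 ℕ.* k)) % 8 ≢ 5
1+2[1+2k]%8≢5 k n%8≡5 = contradiction (begin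
  3                        ≡⟨ [m+kn]%n≡m%n 3 k 4 ⟨
  (3 ℕ.+ k ℕ.* 4) % 4      ≡⟨ cong (_% 4) (n≡3+4k k) ⟨
  n % 4                    ≡⟨ m∣n⇒o%n%m≡o%m 4 8 n (divides 2 refl) ⟨
  n % 8 % 4                ≡⟨ cong (_% 4) n%8≡5 ⟩
  1                        ∎) λ ()
  where
  open ≡.≡-Reasoning
  n = 1 ℕ.+ 2 ℕ.* (1 ℕ.+ 2 ℕ.* k)
  n≡3+4k : ∀ m → 1 ℕ.+ 2 ℕ.* (1 ℕ.+ 2 ℕ.* m) ≡ 3 ℕ.+ m ℕ.* 4
  n≡3+4k = solve-∀

1+2[2[2k]]%8≢5 : ∀ k → (1 ℕ.+ 2 ℕ.* (2 ℕ.* (2 ℕ.* k))) % 8 ≢ 5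
1+2[2[2k]]%8≢5 k n%8≡5 = contradiction (begin
  1                        ≡⟨ [m+kn]%n≡m%n 1 k 8 ⟨
  (1 ℕ.+ k ℕ.* 8) % 8      ≡⟨ cong (_% 8) (n≡1+8k k) ⟨
  n % 8                    ≡⟨ n%8≡5 ⟩
  5                        ∎) λ ()
  where
  open ≡.≡-Reasoning
  n = 1 ℕ.+ 2 ℕ.* (2 ℕ.* (2 ℕ.* k))
  n≡1+8k : ∀ m → 1 ℕ.+ 2 ℕ.* (2 ℕ.* (2 ℕ.* m)) ≡ 1 ℕ.+ m ℕ.* 8
  n≡1+8k = solve-∀

module FiniteFieldSquares {q : ℕ} (F : FiniteField q) where
  open FiniteField F
  open ≡.≡-Reasoning

  commutativeRing : CommutativeRing 0ℓ 0ℓ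
  commutativeRing = record { isCommutativeRing = isCommutativeRing }

  open CommutativeRing commutativeRing using (_-_; +-comm; *-comm; *-assoc; *-identityˡ; zeroˡ; zeroʳ)
  open import Algebra.Properties.Ring (CommutativeRing.ring commutativeRing)
    using (x∙y⁻¹≈ε⇒x≈y; x≈y⇒x∙y⁻¹≈ε; +-inverseˡ-unique; -‿involutive; -0#≈0#)
  open IntegerCoefficientRingSolver commutativeRing
  open Counting card public

  nonzero? : Decidable (_≢ 0#)
  nonzero? x = ¬? (x ≟ 0#)

  zero-product : ∀ {x y} → x * y ≡ 0# → x ≡ 0# ⊎ y ≡ 0#
  zero-product {x} {y} xy≡0 with x ≟ 0#
  ... | yes x≡0 = inj₁ x≡0
  ... | no x≢0 = let (x′ , xx′≡1) = inverse x x≢0 in inj₂ (begin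
    y              ≡⟨ *-identityˡ y ⟨
    1# * y         ≡⟨ cong (_* y) xx′≡1 ⟨
    x * x′ * y     ≡⟨ solve 3 (λ x x′ y → x :* x′ :* y := x′ :* (x :* y)) refl x x′ y ⟩
    x′ * (x * y)   ≡⟨ cong (x′ *_) xy≡0 ⟩
    x′ * 0#        ≡⟨ zeroʳ x′ ⟩
    0#             ∎)

  *-nonzero : ∀ {x y} → x ≢ 0# → y ≢ 0# → x * y ≢ 0#
  *-nonzero x≢0 y≢0 xy≡0 = Sum.[ x≢0 , y≢0 ] (zero-product xy≡0)

  nonzero-*⇒nonzero : ∀ {x y} → x * y ≢ 0# → x ≢ 0# × y ≢ 0#
  nonzero-*⇒nonzero {x} {y} xy≢0 =
    (λ x≡0 → xy≢0 (≡.trans (cong (_* y) x≡0) (zeroˡ y))) ,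
    (λ y≡0 → xy≢0 (≡.trans (cong (x *_) y≡0) (zeroʳ x)))

  difference-nonzero⇒≢ : ∀ {x y} → x - y ≢ 0# → x ≢ y
  difference-nonzero⇒≢ x-y≢0 x≡y = x-y≢0 (x≈y⇒x∙y⁻¹≈ε x≡y)

  *-cancelˡ : ∀ {x y z} → x ≢ 0# → x * y ≡ x * z → y ≡ z
  *-cancelˡ {x} {y} {z} x≢0 xy≡xz =
    Sum.[ (λ x≡0 → ⊥-elim (x≢0 x≡0)) , x∙y⁻¹≈ε⇒x≈y y z ] (zero-product (begin
    x * (y - z)    ≡⟨ solve 3 (λ x y z → x :* (y :- z) := x :* y :- x :* z) refl x y z ⟩
    x * y - x * z  ≡⟨ x≈y⇒x∙y⁻¹≈ε xy≡xz ⟩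
    0#             ∎))

  square-roots : ∀ {x y} → x * x ≡ y * y → x ≡ y ⊎ x ≡ - y
  square-roots {x} {y} x²≡y² =
    Sum.map (x∙y⁻¹≈ε⇒x≈y x y) (+-inverseˡ-unique x y) (zero-product (begin
      (x - y) * (x + y)  ≡⟨ solve 2 (λ x y → (x :- y) :* (x :+ y) := x :* x :- y :* y) refl x y ⟩
      x * x - y * y      ≡⟨ x≈y⇒x∙y⁻¹≈ε x²≡y² ⟩
      0#                 ∎))

  ≢⇒difference-nonzero : ∀ {x y} → x ≢ y → x - y ≢ 0#
  ≢⇒difference-nonzero x≢y x-y≡0 = x≢y (x∙y⁻¹≈ε⇒x≈y _ _ x-y≡0)

  neg-square : ∀ x → - x * - x ≡ x * x
  neg-square = solve 1 (λ x → :- x :* :- x := x :* x) refl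

  1≢0 : 1# ≢ 0#
  1≢0 1≡0 = 0≢1 (≡.sym 1≡0)

  sqrt-1-nonzero : ∀ {i} → i * i ≡ - 1# → i ≢ 0#
  sqrt-1-nonzero {i} i*i≡-1 i≡0 = 1≢0 (begin
    1#          ≡⟨ -‿involutive 1# ⟨
    - - 1#      ≡⟨ cong -_ i*i≡-1 ⟨
    - (i * i)   ≡⟨ cong (λ u → - (u * u)) i≡0 ⟩
    - (0# * 0#) ≡⟨ solve 0 (:- (:0 :* :0) := :0) refl ⟩
    0#          ∎)

  inverse-unique : ∀ {x y z} → x * y ≡ 1# → x * z ≡ 1# → y ≡ z
  inverse-unique {x} {y} {z} xy≡1 xz≡1 = begin
    y              ≡⟨ solve 1 (λ y → y := y :* :1) refl y ⟩
    y * 1#         ≡⟨ cong (y *_) xz≡1 ⟨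
    y * (x * z)    ≡⟨ solve 3 (λ x y z → y :* (x :* z) := x :* y :* z) refl x y z ⟩
    x * y * z      ≡⟨ cong (_* z) xy≡1 ⟩
    1# * z         ≡⟨ *-identityˡ z ⟩
    z              ∎

  -- 0# ⁻¹ is a junk value.
  _⁻¹ : Carrier → Carrier
  x ⁻¹ with x ≟ 0#
  ... | yes _   = 0#
  ... | no x≢0  = proj₁ (inverse x x≢0)

  *-inverseʳ : ∀ {x} → x ≢ 0# → x * x ⁻¹ ≡ 1#
  *-inverseʳ {x} x≢0 with x ≟ 0#
  ... | yes x≡0 = ⊥-elim (x≢0 x≡0)
  ... | no x≢0  = proj₂ (inverse x x≢0)

  ⁻¹-nonzero : ∀ {x} → x ≢ 0# → x ⁻¹ ≢ 0#
  ⁻¹-nonzero {x} x≢0 x⁻¹≡0 =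
    1≢0 (≡.trans (≡.sym (*-inverseʳ x≢0)) (≡.trans (cong (x *_) x⁻¹≡0) (zeroʳ x)))

  ⁻¹-involutive : ∀ {x} → x ≢ 0# → x ⁻¹ ⁻¹ ≡ x
  ⁻¹-involutive {x} x≢0 =
    inverse-unique (*-inverseʳ (⁻¹-nonzero x≢0)) (≡.trans (*-comm (x ⁻¹) x) (*-inverseʳ x≢0))

  IsSquareUnit? : Decidable IsSquareUnit
  IsSquareUnit? = image? (λ t → t * t) nonzero?

  square⇒nonzero : ∀ {x} → IsSquareUnit x → x ≢ 0#
  square⇒nonzero (t , t≢0 , refl) = *-nonzero t≢0 t≢0

  square-* : ∀ {x y} → IsSquareUnit x → IsSquareUnit y → IsSquareUnit (x * y)
  square-* (s , s≢0 , refl) (t , t≢0 , refl) =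
    s * t , *-nonzero s≢0 t≢0 , solve 2 (λ s t → (s :* t) :* (s :* t) := (s :* s) :* (t :* t)) refl s t

  square-*-cancelʳ : ∀ {x y} → IsSquareUnit (x * y) → IsSquareUnit y → IsSquareUnit x
  square-*-cancelʳ {x} (s , s≢0 , ss≡xtt) (t , t≢0 , refl) =
    s * t ⁻¹ , *-nonzero s≢0 (⁻¹-nonzero t≢0) , (begin
      (s * t′) * (s * t′)          ≡⟨ solve 2 (λ s t′ → (s :* t′) :* (s :* t′) := (s :* s) :* (t′ :* t′))
                                             refl s t′ ⟩
      (s * s) * (t′ * t′)          ≡⟨ cong (_* (t′ * t′)) ss≡xtt ⟩
      x * (t * t) * (t′ * t′)      ≡⟨ solve 3 (λ x t t′ → x :* (t :* t) :* (t′ :* t′) := x :* ((t :* t′) :* (t :* t′)))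
                                             refl x t t′ ⟩
      x * ((t * t′) * (t * t′))    ≡⟨ cong (λ u → x * (u * u)) (*-inverseʳ t≢0) ⟩
      x * (1# * 1#)                ≡⟨ solve 1 (λ x → x :* (:1 :* :1) := x) refl x ⟩
      x                            ∎)
    where t′ = t ⁻¹

  square-⁻¹ : ∀ {x} → IsSquareUnit x → IsSquareUnit (x ⁻¹)
  square-⁻¹ (t , t≢0 , refl) =
    t ⁻¹ , ⁻¹-nonzero t≢0 ,
    inverse-unique (≡.trans (solve 2 (λ t t′ → (t :* t) :* (t′ :* t′) := (t :* t′) :* (t :* t′)) refl t (t ⁻¹))
                            (≡.trans (cong (λ u → u * u) (*-inverseʳ t≢0)) (*-identityˡ 1#)))
                   (*-inverseʳ (*-nonzero t≢0 t≢0))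

  module Characteristic≢2 (2≢0 : 2# ≢ 0#) where

    -x≢x : ∀ {x} → x ≢ 0# → - x ≢ x
    -x≢x {x} x≢0 -x≡x = *-nonzero 2≢0 x≢0 (begin
      2# * x   ≡⟨ solve 1 (λ x → :2 :* x := x :- :- x) refl x ⟩
      x - - x  ≡⟨ x≈y⇒x∙y⁻¹≈ε (≡.sym -x≡x) ⟩
      0#       ∎)

    count≡2*count-squares : {P : Pred Carrier 0ℓ} (P? : Decidable P) →
      (∀ {x} → P x → x ≢ 0#) → (∀ {x} → P x → P (- x)) →
      count P? ≡ 2 ℕ.* count (image? (λ x → x * x) P?)
    count≡2*count-squares P? P⇒nonzero P⇒P- =
      count-two-to-one P? (λ x → x * x) -_ P⇒P- (λ Px → -x≢x (P⇒nonzero Px)) (λ {x} _ → neg-square x)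
        (λ _ _ → square-roots)

    count-nonzero : count nonzero? ≡ 2 ℕ.* count IsSquareUnit?
    count-nonzero = count≡2*count-squares nonzero? (λ x≢0 → x≢0) (λ {x} x≢0 -x≡0 → x≢0 (begin
      x      ≡⟨ -‿involutive x ⟨
      - - x  ≡⟨ cong -_ -x≡0 ⟩
      - 0#   ≡⟨ -0#≈0# ⟩
      0#     ∎))

    q≡1+2*count-squares : q ≡ 1 ℕ.+ 2 ℕ.* count IsSquareUnit?
    q≡1+2*count-squares = begin
      q                                                   ≡⟨ count-U ⟨
      count U?                                            ≡⟨ count-split U? (_≟ 0#) ⟩
      count (U? ∩? (_≟ 0#)) ℕ.+ count (U? ∩? ∁? (_≟ 0#))   ≡⟨ ≡.cong₂ ℕ._+_ (count-singleton U? _)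
                                                               (count-cong _ nonzero? (proj₂ , (_ ,_))) ⟩
      1 ℕ.+ count nonzero?                                ≡⟨ cong (1 ℕ.+_) count-nonzero ⟩
      1 ℕ.+ 2 ℕ.* count IsSquareUnit?                     ∎

    count-nonsquares : count (nonzero? ∩? ∁? IsSquareUnit?) ≡ count IsSquareUnit?
    count-nonsquares = ℕ.+-cancelˡ-≡ squares _ _ (begin
      squares ℕ.+ nonsquares                                ≡⟨ cong (ℕ._+ nonsquares) nonzero-squares≡squares ⟨
      count (nonzero? ∩? IsSquareUnit?) ℕ.+ nonsquares      ≡⟨ count-split nonzero? IsSquareUnit? ⟨
      count nonzero?                                        ≡⟨ count-nonzero ⟩
      2 ℕ.* squares                                         ≡⟨ cong (squares ℕ.+_) (ℕ.+-identityʳ _) ⟩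
      squares ℕ.+ squares                                   ∎)
      where
      squares = count IsSquareUnit?
      nonsquares = count (nonzero? ∩? ∁? IsSquareUnit?)
      nonzero-squares≡squares : count (nonzero? ∩? IsSquareUnit?) ≡ squares
      nonzero-squares≡squares = count-cong _ IsSquareUnit? (proj₂ , λ x∈□ → square⇒nonzero x∈□ , x∈□)

    nonsquare-*-nonsquare : ∀ {x y} → x ≢ 0# → y ≢ 0# → ¬ IsSquareUnit x → ¬ IsSquareUnit y →
                            IsSquareUnit (x * y)
    nonsquare-*-nonsquare {x} {y} x≢0 y≢0 x∉□ y∉□ = decidable-stable (IsSquareUnit? (x * y)) λ xy∉□ →
      ℕ.<-irrefl refl (ℕ.≤-trans (s≤s (x*-squares≤ xy∉□)) (ℕ.≤-reflexive (begin
        1 ℕ.+ count Nonsquare-y?                              ≡⟨ cong (ℕ._+ count Nonsquare-y?) y-singleton ⟨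
        count (Nonsquare? ∩? (_≟ y)) ℕ.+ count Nonsquare-y?   ≡⟨ count-split Nonsquare? (_≟ y) ⟨
        count Nonsquare?                                      ≡⟨ count-nonsquares ⟩
        count IsSquareUnit?                                   ∎)))
      where
      Nonsquare? = nonzero? ∩? ∁? IsSquareUnit?
      Nonsquare-y? = Nonsquare? ∩? ∁? (_≟ y)
      y-singleton = count-singleton Nonsquare? (y≢0 , y∉□)
      x*-squares≤ : ¬ IsSquareUnit (x * y) → count IsSquareUnit? ≤ count Nonsquare-y?
      x*-squares≤ xy∉□ = injective⇒count≤ IsSquareUnit? Nonsquare-y? (x *_)
        (λ {z} z∈□ → (*-nonzero x≢0 (square⇒nonzero z∈□) , λ xz∈□ → x∉□ (square-*-cancelʳ xz∈□ z∈□)) ,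
           λ xz≡y → xy∉□ (subst IsSquareUnit
             (≡.trans (*-assoc x x z) (cong (x *_) xz≡y)) (square-* (x , x≢0 , refl) z∈□)))
        (λ _ _ → *-cancelˡ x≢0)

    exactly-one-square : ∀ {i u v} → ¬ IsSquareUnit i → IsSquareUnit (i * (u * v)) →
                         (IsSquareUnit u ⊎ IsSquareUnit v) × ¬ (IsSquareUnit u × IsSquareUnit v)
    exactly-one-square {i} {u} {v} i∉□ iuv∈□ =
      at-least-one , λ (u∈□ , v∈□) → i∉□ (square-*-cancelʳ iuv∈□ (square-* u∈□ v∈□))
      where
      u≢0×v≢0 = nonzero-*⇒nonzero (proj₂ (nonzero-*⇒nonzero (square⇒nonzero iuv∈□)))
      at-least-one : IsSquareUnit u ⊎ IsSquareUnit v
      at-least-one with IsSquareUnit? u | IsSquareUnit? v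
      ... | yes u∈□ | _       = inj₁ u∈□
      ... | no _    | yes v∈□ = inj₂ v∈□
      ... | no u∉□  | no v∉□  = ⊥-elim (i∉□ (square-*-cancelʳ iuv∈□
              (nonsquare-*-nonsquare (proj₁ u≢0×v≢0) (proj₂ u≢0×v≢0) u∉□ v∉□)))

    1-square : IsSquareUnit 1#
    1-square = 1# , 1≢0 , *-identityˡ 1#

    -- Inversion pairs off the squares other than 1#, without fixed points unless - 1# is a square.
    count-squares-odd : ¬ IsSquareUnit (- 1#) → ∃[ k ] count IsSquareUnit? ≡ 1 ℕ.+ 2 ℕ.* k
    count-squares-odd -1∉□ = count (image? (λ x → x + x ⁻¹) NonOne?) , (begin
      count IsSquareUnit?                                  ≡⟨ count-split IsSquareUnit? (_≟ 1#) ⟩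
      count (IsSquareUnit? ∩? (_≟ 1#)) ℕ.+ count NonOne?   ≡⟨ ≡.cong₂ ℕ._+_ (count-singleton IsSquareUnit? 1-square)
                                                                            count-NonOne ⟩
      1 ℕ.+ 2 ℕ.* count (image? (λ x → x + x ⁻¹) NonOne?)  ∎)
      where
      NonOne? = IsSquareUnit? ∩? ∁? (_≟ 1#)
      NonOne = IsSquareUnit ∩ ∁ (_≡ 1#)

      ⁻¹-closed : ∀ {x} → NonOne x → NonOne (x ⁻¹)
      ⁻¹-closed {x} (x∈□ , x≢1) = square-⁻¹ x∈□ , λ x⁻¹≡1 → x≢1 (begin
        x           ≡⟨ solve 1 (λ x → x := x :* :1) refl x ⟩
        x * 1#      ≡⟨ cong (x *_) x⁻¹≡1 ⟨
        x * x ⁻¹    ≡⟨ *-inverseʳ (square⇒nonzero x∈□) ⟩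
        1#          ∎)

      ⁻¹-fixedPointFree : ∀ {x} → NonOne x → x ⁻¹ ≢ x
      ⁻¹-fixedPointFree {x} (x∈□ , x≢1) x⁻¹≡x with square-roots (begin
        x * x       ≡⟨ cong (x *_) x⁻¹≡x ⟨
        x * x ⁻¹    ≡⟨ *-inverseʳ (square⇒nonzero x∈□) ⟩
        1#          ≡⟨ *-identityˡ 1# ⟨
        1# * 1#     ∎)
      ... | inj₁ x≡1  = x≢1 x≡1
      ... | inj₂ x≡-1 = -1∉□ (subst IsSquareUnit x≡-1 x∈□)

      φ∘⁻¹≡φ : ∀ {x} → NonOne x → x ⁻¹ + x ⁻¹ ⁻¹ ≡ x + x ⁻¹
      φ∘⁻¹≡φ {x} (x∈□ , _) =
        ≡.trans (cong (x ⁻¹ +_) (⁻¹-involutive (square⇒nonzero x∈□))) (+-comm (x ⁻¹) x)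

      φ-fibres : ∀ {x y} → NonOne x → NonOne y → x + x ⁻¹ ≡ y + y ⁻¹ → x ≡ y ⊎ x ≡ y ⁻¹
      φ-fibres {x} {y} (x∈□ , _) (y∈□ , _) φx≡φy =
        Sum.map (x∙y⁻¹≈ε⇒x≈y x y) xy≡1⇒x≡y⁻¹ (zero-product [x-y][xy-1]≡0)
        where
        xy≡1⇒x≡y⁻¹ : x * y - 1# ≡ 0# → x ≡ y ⁻¹
        xy≡1⇒x≡y⁻¹ xy-1≡0 =
          inverse-unique (≡.trans (*-comm y x) (x∙y⁻¹≈ε⇒x≈y _ _ xy-1≡0)) (*-inverseʳ (square⇒nonzero y∈□))

        [x-y][xy-1]≡0 : (x - y) * (x * y - 1#) ≡ 0#
        [x-y][xy-1]≡0 = begin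
          (x - y) * (x * y - 1#)
            ≡⟨ solve 4 (λ x y x′ y′ → (x :- y) :* (x :* y :- :1) :=
                 x :* y :* (x :+ x′) :- x :* y :* (y :+ y′) :+ y :* (:1 :- x :* x′) :- x :* (:1 :- y :* y′))
                 refl x y (x ⁻¹) (y ⁻¹) ⟩
          x * y * (x + x ⁻¹) - x * y * (y + y ⁻¹) + y * (1# - x * x ⁻¹) - x * (1# - y * y ⁻¹)
            ≡⟨ cong (λ u → x * y * u - x * y * (y + y ⁻¹) + y * (1# - x * x ⁻¹) - x * (1# - y * y ⁻¹)) φx≡φy ⟩
          x * y * (y + y ⁻¹) - x * y * (y + y ⁻¹) + y * (1# - x * x ⁻¹) - x * (1# - y * y ⁻¹)
            ≡⟨ ≡.cong₂ (λ u v → x * y * (y + y ⁻¹) - x * y * (y + y ⁻¹) + y * (1# - u) - x * (1# - v))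
                 (*-inverseʳ (square⇒nonzero x∈□)) (*-inverseʳ (square⇒nonzero y∈□)) ⟩
          x * y * (y + y ⁻¹) - x * y * (y + y ⁻¹) + y * (1# - 1#) - x * (1# - 1#)
            ≡⟨ solve 3 (λ x y z → z :- z :+ y :* (:1 :- :1) :- x :* (:1 :- :1) := :0)
                 refl x y (x * y * (y + y ⁻¹)) ⟩
          0#
            ∎

      count-NonOne : count NonOne? ≡ 2 ℕ.* count (image? (λ x → x + x ⁻¹) NonOne?)
      count-NonOne = count-two-to-one NonOne? (λ x → x + x ⁻¹) _⁻¹
                       ⁻¹-closed ⁻¹-fixedPointFree φ∘⁻¹≡φ φ-fibres

    -1-square : q % 8 ≡ 5 → IsSquareUnit (- 1#)
    -1-square q%8≡5 = decidable-stable (IsSquareUnit? (- 1#)) λ -1∉□ →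
      let (k , S≡1+2k) = count-squares-odd -1∉□ in
      1+2[1+2k]%8≢5 k (subst (λ n → n % 8 ≡ 5)
        (≡.trans q≡1+2*count-squares (cong (λ s → 1 ℕ.+ 2 ℕ.* s) S≡1+2k)) q%8≡5)

    count-squares≡4k : ∀ {i} → i * i ≡ - 1# → IsSquareUnit i →
                       ∃[ k ] count IsSquareUnit? ≡ 2 ℕ.* (2 ℕ.* k)
    count-squares≡4k {i} i*i≡-1 i∈□ = count (image? (λ x → x * x) Squares²?) , (begin
      count IsSquareUnit?    ≡⟨ count≡2*count-squares IsSquareUnit? square⇒nonzero square⇒-square ⟩
      2 ℕ.* count Squares²?  ≡⟨ cong (2 ℕ.*_) (count≡2*count-squares Squares²? Squares²⇒nonzero Squares²⇒-Squares²) ⟩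
      2 ℕ.* (2 ℕ.* count (image? (λ x → x * x) Squares²?)) ∎)
      where
      i≢0 = square⇒nonzero i∈□
      Squares² = image (λ x → x * x) IsSquareUnit
      Squares²? = image? (λ x → x * x) IsSquareUnit?

      [ix]*[ix]≡-y : ∀ {x y} → x * x ≡ y → (i * x) * (i * x) ≡ - y
      [ix]*[ix]≡-y {x} refl = begin
        (i * x) * (i * x)   ≡⟨ solve 2 (λ i x → (i :* x) :* (i :* x) := i :* i :* (x :* x)) refl i x ⟩
        i * i * (x * x)     ≡⟨ cong (_* (x * x)) i*i≡-1 ⟩
        - 1# * (x * x)      ≡⟨ solve 1 (λ y → :- :1 :* y := :- y) refl (x * x) ⟩
        - (x * x)           ∎

      square⇒-square : ∀ {x} → IsSquareUnit x → IsSquareUnit (- x)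
      square⇒-square (t , t≢0 , t*t≡x) = i * t , *-nonzero i≢0 t≢0 , [ix]*[ix]≡-y t*t≡x

      Squares²⇒nonzero : ∀ {y} → Squares² y → y ≢ 0#
      Squares²⇒nonzero (x , x∈□ , refl) = *-nonzero (square⇒nonzero x∈□) (square⇒nonzero x∈□)

      Squares²⇒-Squares² : ∀ {y} → Squares² y → Squares² (- y)
      Squares²⇒-Squares² (x , x∈□ , x*x≡y) = i * x , square-* i∈□ x∈□ , [ix]*[ix]≡-y x*x≡y

    sqrt-1-nonsquare : q % 8 ≡ 5 → ∀ {i} → i * i ≡ - 1# → ¬ IsSquareUnit i
    sqrt-1-nonsquare q%8≡5 i*i≡-1 i∈□ =
      let (k , S≡4k) = count-squares≡4k i*i≡-1 i∈□ in
      1+2[2[2k]]%8≢5 k (subst (λ n → n % 8 ≡ 5)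
        (≡.trans q≡1+2*count-squares (cong (λ s → 1 ℕ.+ 2 ℕ.* s) S≡4k)) q%8≡5)

    sqrt-1 : q % 8 ≡ 5 → ∃[ i ] (i * i ≡ - 1# × ¬ IsSquareUnit i)
    sqrt-1 q%8≡5 = let (i , _ , i*i≡-1) = -1-square q%8≡5 in
      i , i*i≡-1 , sqrt-1-nonsquare q%8≡5 i*i≡-1

module AGMPreimages {q : ℕ} (F : FiniteField q) where
  open FiniteField F
  open FiniteFieldSquares F
  open CommutativeRing commutativeRing using (_-_; +-comm; *-comm; zeroʳ)
  open import Algebra.Properties.Ring (CommutativeRing.ring commutativeRing) using (+-inverseˡ-unique; -‿involutive)
  open IntegerCoefficientRingSolver commutativeRing
  open ≡.≡-Reasoning

  Δ : Carrier → Carrier → Carrier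
  Δ a b = a * a - b * b

  HasPreimage : Carrier → Carrier → Set
  HasPreimage a b = ∃[ a′ ] ∃[ b′ ] (V a′ b′ × (a′ , b′) ↦ (a , b))

  V-swap : ∀ {a b} → V a b → V b a
  V-swap {a} {b} (a≢0 , b≢0 , a≢b , a≢-b) =
    b≢0 , a≢0 , (λ b≡a → a≢b (≡.sym b≡a)) ,
    λ b≡-a → a≢-b (≡.trans (≡.sym (-‿involutive a)) (cong -_ (≡.sym b≡-a)))

  AGM-swap : ∀ {a b x y} → AGM a b x y → AGM b a x y
  AGM-swap {a} {b} (ab∈□ , s , s*s≡ab , x*2≡a+b , y≡±s) =
    subst IsSquareUnit (*-comm a b) ab∈□ , s , ≡.trans s*s≡ab (*-comm a b) , ≡.trans x*2≡a+b (+-comm a b) , y≡±s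

  AGM⇒y*y≡a*b : ∀ {a b x y} → AGM a b x y → y * y ≡ a * b
  AGM⇒y*y≡a*b (_ , s , s*s≡ab , _ , inj₁ refl) = s*s≡ab
  AGM⇒y*y≡a*b (_ , s , s*s≡ab , _ , inj₂ refl) = ≡.trans (neg-square s) s*s≡ab

  AGM⇒2≢0 : ∀ {a b x y} → V a b → AGM a b x y → 2# ≢ 0#
  AGM⇒2≢0 {a} {b} {x} (_ , _ , _ , a≢-b) (_ , _ , _ , x*2≡a+b , _) 2≡0 =
    a≢-b (+-inverseˡ-unique a b (begin
      a + b    ≡⟨ x*2≡a+b ⟨
      x * 2#   ≡⟨ cong (x *_) 2≡0 ⟩
      x * 0#   ≡⟨ zeroʳ x ⟩
      0#       ∎))

  Δ≡x*2*[a-b] : ∀ {a b x y} → AGM a b x y → Δ a b ≡ x * 2# * (a - b)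
  Δ≡x*2*[a-b] {a} {b} {x} (_ , _ , _ , x*2≡a+b , _) = begin
    a * a - b * b        ≡⟨ solve 2 (λ a b → a :* a :- b :* b := (a :+ b) :* (a :- b)) refl a b ⟩
    (a + b) * (a - b)    ≡⟨ cong (_* (a - b)) x*2≡a+b ⟨
    x * 2# * (a - b)     ∎

  [a-b]²≡4Δ : ∀ {a b x y} → AGM a b x y → (a - b) * (a - b) ≡ 2# * 2# * Δ x y
  [a-b]²≡4Δ {a} {b} {x} {y} ab↦xy@(_ , _ , _ , x*2≡a+b , _) = begin
    (a - b) * (a - b)                      ≡⟨ solve 2 (λ a b → (a :- b) :* (a :- b) :=
                                                (a :+ b) :* (a :+ b) :- :2 :* :2 :* (a :* b)) refl a b ⟩
    (a + b) * (a + b) - 2# * 2# * (a * b)  ≡⟨ ≡.cong₂ (λ u v → u * u - 2# * 2# * v) x*2≡a+b (AGM⇒y*y≡a*b ab↦xy) ⟨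
    x * 2# * (x * 2#) - 2# * 2# * (y * y)  ≡⟨ solve 2 (λ x y → x :* :2 :* (x :* :2) :- :2 :* :2 :* (y :* y) :=
                                                :2 :* :2 :* (x :* x :- y :* y)) refl x y ⟩
    2# * 2# * Δ x y                        ∎

  module _ (2≢0 : 2# ≢ 0#) where
    open Characteristic≢2 2≢0

    preimage⇒square : ∀ {a b} → HasPreimage a b → IsSquareUnit (Δ a b)
    preimage⇒square {a} {b} (a′ , b′ , (_ , _ , a′≢b′ , _) , a′b′↦ab) =
      square-*-cancelʳ (subst IsSquareUnit (≡.trans ([a-b]²≡4Δ a′b′↦ab) (*-comm (2# * 2#) (Δ a b)))
                                           (a′ - b′ , ≢⇒difference-nonzero a′≢b′ , refl))
                       (2# , 2≢0 , refl)

    square⇒preimage : ∀ {a b} → V a b → IsSquareUnit (Δ a b) → HasPreimage a b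
    square⇒preimage {a} {b} (a≢0 , b≢0 , _ , _) (t , t≢0 , t*t≡Δ) =
      a + t , a - t , (a+t≢0 , a-t≢0 , a+t≢a-t , a+t≢-[a-t]) ,
      (b , b≢0 , b*b≡[a+t][a-t]) , b , b*b≡[a+t][a-t] ,
      solve 2 (λ a t → a :* :2 := (a :+ t) :+ (a :- t)) refl a t , inj₁ refl
      where
      b*b≡[a+t][a-t] : b * b ≡ (a + t) * (a - t)
      b*b≡[a+t][a-t] = begin
        b * b                  ≡⟨ solve 2 (λ a b → b :* b := a :* a :- (a :* a :- b :* b)) refl a b ⟩
        a * a - Δ a b          ≡⟨ cong (λ u → a * a - u) t*t≡Δ ⟨
        a * a - t * t          ≡⟨ solve 2 (λ a t → a :* a :- t :* t := (a :+ t) :* (a :- t)) refl a t ⟩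
        (a + t) * (a - t)      ∎
      a±t≢0 = nonzero-*⇒nonzero (subst (_≢ 0#) b*b≡[a+t][a-t] (*-nonzero b≢0 b≢0))
      a+t≢0 = proj₁ a±t≢0
      a-t≢0 = proj₂ a±t≢0
      a+t≢a-t : a + t ≢ a - t
      a+t≢a-t = difference-nonzero⇒≢ (subst (_≢ 0#)
        (solve 2 (λ a t → :2 :* t := (a :+ t) :- (a :- t)) refl a t) (*-nonzero 2≢0 t≢0))
      a+t≢-[a-t] : a + t ≢ - (a - t)
      a+t≢-[a-t] = difference-nonzero⇒≢ (subst (_≢ 0#)
        (solve 2 (λ a t → :2 :* a := (a :+ t) :- :- (a :- t)) refl a t) (*-nonzero 2≢0 a≢0))

    preimage-swap : ∀ {i a b} → i * i ≡ - 1# → V a b → HasPreimage a b → HasPreimage b a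
    preimage-swap {i} {a} {b} i*i≡-1 Vab ab-preimage =
      square⇒preimage (V-swap Vab) (subst IsSquareUnit i*i*Δab≡Δba
        (square-* (i , sqrt-1-nonzero i*i≡-1 , refl) (preimage⇒square ab-preimage)))
      where
      i*i*Δab≡Δba : i * i * Δ a b ≡ Δ b a
      i*i*Δab≡Δba = begin
        i * i * Δ a b    ≡⟨ cong (_* Δ a b) i*i≡-1 ⟩
        - 1# * Δ a b     ≡⟨ solve 2 (λ a b → :- :1 :* (a :* a :- b :* b) := b :* b :- a :* a) refl a b ⟩
        Δ b a            ∎

    i*Δ*Δ-square : ∀ {i a b c e a₀ b₀} → i * i ≡ - 1# → IsSquareUnit (a₀ * b₀) → V a b →
                   AGM a b a₀ b₀ → AGM c e b₀ a₀ → IsSquareUnit (i * (Δ a b * Δ c e))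
    i*Δ*Δ-square {i} {a} {b} {c} {e} {a₀} {b₀} i*i≡-1 a₀b₀∈□ (_ , _ , a≢b , _) ab↦ ce↦ =
      subst IsSquareUnit (≡.sym i*Δ*Δ≡4*a₀b₀*idf) (square-* (square-* (2# , 2≢0 , refl) a₀b₀∈□) idf∈□)
      where
      d = a - b
      f = c - e
      d≢0 = ≢⇒difference-nonzero a≢b
      i≢0 = sqrt-1-nonzero i*i≡-1

      f*f≡[id]*[id] : f * f ≡ (i * d) * (i * d)
      f*f≡[id]*[id] = begin
        f * f                      ≡⟨ [a-b]²≡4Δ ce↦ ⟩
        2# * 2# * Δ b₀ a₀          ≡⟨ solve 2 (λ a₀ b₀ → :2 :* :2 :* (b₀ :* b₀ :- a₀ :* a₀) :=
                                        :- :1 :* (:2 :* :2 :* (a₀ :* a₀ :- b₀ :* b₀))) refl a₀ b₀ ⟩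
        - 1# * (2# * 2# * Δ a₀ b₀) ≡⟨ ≡.cong₂ _*_ i*i≡-1 ([a-b]²≡4Δ ab↦) ⟨
        i * i * (d * d)            ≡⟨ solve 2 (λ i d → i :* i :* (d :* d) := i :* d :* (i :* d)) refl i d ⟩
        (i * d) * (i * d)          ∎

      idf∈□ : IsSquareUnit (i * d * f)
      idf∈□ with square-roots f*f≡[id]*[id]
      ... | inj₁ f≡id  = i * d , *-nonzero i≢0 d≢0 , cong (i * d *_) (≡.sym f≡id)
      ... | inj₂ f≡-id = d , d≢0 , (begin
        d * d                   ≡⟨ solve 1 (λ d → d :* d := :- (:- :1 :* (d :* d))) refl d ⟩
        - (- 1# * (d * d))      ≡⟨ cong (λ u → - (u * (d * d))) i*i≡-1 ⟨
        - (i * i * (d * d))     ≡⟨ solve 2 (λ i d → :- (i :* i :* (d :* d)) := i :* d :* :- (i :* d)) refl i d ⟩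
        i * d * - (i * d)       ≡⟨ cong (i * d *_) f≡-id ⟨
        i * d * f               ∎)

      i*Δ*Δ≡4*a₀b₀*idf : i * (Δ a b * Δ c e) ≡ 2# * 2# * (a₀ * b₀) * (i * d * f)
      i*Δ*Δ≡4*a₀b₀*idf = begin
        i * (Δ a b * Δ c e)                    ≡⟨ ≡.cong₂ (λ u v → i * (u * v)) (Δ≡x*2*[a-b] ab↦) (Δ≡x*2*[a-b] ce↦) ⟩
        i * (a₀ * 2# * d * (b₀ * 2# * f))      ≡⟨ solve 5 (λ i a₀ b₀ d f → i :* (a₀ :* :2 :* d :* (b₀ :* :2 :* f)) :=
                                                    :2 :* :2 :* (a₀ :* b₀) :* (i :* d :* f)) refl i a₀ b₀ d f ⟩
        2# * 2# * (a₀ * b₀) * (i * d * f)      ∎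

    exactly-one-preimage : ∀ {i a b c e a₀ b₀} → i * i ≡ - 1# → ¬ IsSquareUnit i →
      IsSquareUnit (a₀ * b₀) → V a b → AGM a b a₀ b₀ → V c e → AGM c e b₀ a₀ →
      (HasPreimage a b ⊎ HasPreimage c e) × ¬ (HasPreimage a b × HasPreimage c e)
    exactly-one-preimage i*i≡-1 i∉□ a₀b₀∈□ Vab ab↦ Vce ce↦ =
      let (one , not-both) = exactly-one-square i∉□ (i*Δ*Δ-square i*i≡-1 a₀b₀∈□ Vab ab↦ ce↦) in
      Sum.map (square⇒preimage Vab) (square⇒preimage Vce) one ,
      λ (ab-preimage , ce-preimage) → not-both (preimage⇒square ab-preimage , preimage⇒square ce-preimage)

lemma4p10 : (q : ℕ) → IsPrimePower q → q % 8 ≡ 5 → (F : FiniteField q) →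
    let open FiniteField F in
    (a₀ b₀ a₋₁ b₋₁ a₁ b₁ : Carrier) →
    V a₀ b₀ → V a₋₁ b₋₁ → V a₁ b₁ →
    (a₋₁ , b₋₁) ↦ (a₀ , b₀) → (a₀ , b₀) ↦ (a₁ , b₁) →
    (V b₀ a₀ × (∀ x y → AGM b₀ a₀ x y ⇔ AGM a₀ b₀ x y))
    × (∃[ a' ] ∃[ b' ] (V a' b' × (a' , b') ↦ (b₀ , a₀)))
    × ((a' b' : Carrier) → V a' b' → (a' , b') ↦ (b₀ , a₀) →
        let A = ∃[ a₋₂ ] ∃[ b₋₂ ] (V a₋₂ b₋₂ × (a₋₂ , b₋₂) ↦ (a₋₁ , b₋₁))
            B = ∃[ a₋₂' ] ∃[ b₋₂' ] (V a₋₂' b₋₂' × (a₋₂' , b₋₂') ↦ (a' , b'))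
        in (A ⊎ B) × ¬ (A × B))
lemma4p10 q _ q%8≡5 F a₀ b₀ a₋₁ b₋₁ _ _ V₀ V₋₁ _ a₋₁b₋₁↦a₀b₀ a₀b₀↦a₁b₁ =
  let (i , i*i≡-1 , i∉□) = sqrt-1 q%8≡5 in
  (V-swap V₀ , λ _ _ → mk⇔ AGM-swap AGM-swap) ,
  preimage-swap 2≢0 i*i≡-1 V₀ (a₋₁ , b₋₁ , V₋₁ , a₋₁b₋₁↦a₀b₀) ,
  λ _ _ V′ a′b′↦b₀a₀ →
    exactly-one-preimage 2≢0 i*i≡-1 i∉□ (proj₁ a₀b₀↦a₁b₁) V₋₁ a₋₁b₋₁↦a₀b₀ V′ a′b′↦b₀a₀
  where
  open AGMPreimages F
  2≢0 = AGM⇒2≢0 V₋₁ a₋₁b₋₁↦a₀b₀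
  open FiniteFieldSquares.Characteristic≢2 F 2≢0 using (sqrt-1)
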